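{- Let $\mathbf G$ be a finite abelian group, $N=|\mathbf G|$, $n,k$ positive integers, $U\subseteq\mathbf G$ a $k$-universal set, and $S\subseteq\mathbf G^n$ with $|S|=\sigma N^n$. Then $$|U^{nk}-\Delta_{k,\dots,k;n}(S)|\geqslant\sigma N^{nk}.$$ In particular, for any $A,S\subseteq\mathbf G$ and any positive integer $m$, $$|U+A+S|\geqslant N\left(\frac{|S|}{N}\right)^{1/(km)}\overline{\mathcal U}_m(A)^{1/k}.$$
   Context: $U$ is $k$-universal if for any $z_1,\dots,z_k\in\mathbf G$ there is $w\in\mathbf G$ with $z_i+w\in U$ for all $i$. For $x\in\mathbf G$, $\Delta_k(x)=(x,\dots,x)\in\mathbf G^k$; $\Delta_{k,\dots,k;n}(S)=\{(\Delta_k(s_1),\dots,\Delta_k(s_n)):(s_1,\dots,s_n)\in S\}\subseteq\mathbf G^{nk}$; differences in $\mathbf G^{nk}$ are coordinatewise, so $U^{nk}-\Delta_{k,\dots,k;n}(S)=\{u-d: u\in U^{nk}, d\in\Delta_{k,\dots,k;n}(S)\}$. $\mathcal U_m(A)=|A^m-\Delta_m(\mathbf G)|/N^m$ where $A^m-\Delta_m(\mathbf G)=\{(a_1-g,\dots,a_m-g):a_i\in A,g\in\mathbf G\}$, and $\overline{\mathcal U}_m(A)=\mathcal U_m(A)^{1/m}$. -}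

module Defs where

open import Data.Bool using (Bool; true; false; _∧_; if_then_else_)
open import Data.Nat using (ℕ; zero; suc)
open import Data.Fin using (Fin)
open import Data.Fin.Properties using () renaming (_≟_ to _≟ᶠ_)
open import Data.List using (List; []; _∷_; [_]; map; concatMap; allFin)
open import Data.Bool.ListAction using (any; all)
open import Data.Vec using (Vec; []; _∷_; lookup; replicate; zipWith; toList)
open import Data.Vec.Properties using (≡-dec)
open import Data.Product using (Σ; _,_)
open import Relation.Nullary.Decidable using (⌊_⌋)
open import Relation.Binary.PropositionalEquality using (_≡_)
open import Algebra.Structures using (IsAbelianGroup)

-- A finite abelian group G of order N, realised (up to isomorphism) on the
-- carrier Fin N, with an arbitrary abelian group structure.
record FinAbGroup (N : ℕ) : Set where
  field
    _⊕_ : Fin N → Fin N → Fin N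
    ε   : Fin N
    ⊖_  : Fin N → Fin N
    isAbelianGroup : IsAbelianGroup _≡_ _⊕_ ε ⊖_

  _⊝_ : Fin N → Fin N → Fin N
  x ⊝ y = x ⊕ (⊖ y)

open FinAbGroup public

Subset : Set → Set
Subset A = A → Bool

vecs : {A : Set} → List A → (n : ℕ) → List (Vec A n)
vecs xs zero    = [ [] ]
vecs xs (suc n) = concatMap (λ x → map (x ∷_) (vecs xs n)) xs

elems : (N : ℕ) → List (Fin N)
elems N = allFin N

tuples : (N n : ℕ) → List (Vec (Fin N) n)
tuples N n = vecs (allFin N) n

-- enumeration of G^{nk}, organised as n blocks of k coordinates
blocks : (N n k : ℕ) → List (Vec (Vec (Fin N) k) n)
blocks N n k = vecs (tuples N k) n

-- number of elements of a (duplicate-free) enumeration lying in a subset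
count : {A : Set} → List A → Subset A → ℕ
count []       P = zero
count (x ∷ xs) P = if P x then suc (count xs P) else count xs P

card : {N : ℕ} → Subset (Fin N) → ℕ
card {N} X = count (elems N) X

cardⁿ : {N : ℕ} (n : ℕ) → Subset (Vec (Fin N) n) → ℕ
cardⁿ {N} n X = count (tuples N n) X

cardⁿᵏ : {N : ℕ} (n k : ℕ) → Subset (Vec (Vec (Fin N) k) n) → ℕ
cardⁿᵏ {N} n k X = count (blocks N n k) X

KUniversal : {N : ℕ} → FinAbGroup N → (k : ℕ) → Subset (Fin N) → Set
KUniversal {N} G k U =
  (z : Vec (Fin N) k) → Σ (Fin N) λ w → (i : Fin k) → U (_⊕_ G (lookup z i) w) ≡ true

Δ : {N : ℕ} (k : ℕ) → Fin N → Vec (Fin N) k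
Δ k x = replicate k x

Δblocks : {N : ℕ} (n k : ℕ) → Vec (Fin N) n → Vec (Vec (Fin N) k) n
Δblocks n k s = Data.Vec.map (Δ k) s

subBlocks : {N : ℕ} → FinAbGroup N → {n k : ℕ} →
  Vec (Vec (Fin N) k) n → Vec (Vec (Fin N) k) n → Vec (Vec (Fin N) k) n
subBlocks G u d = zipWith (zipWith (_⊝_ G)) u d

inPowerBlocks : {N n k : ℕ} → Subset (Fin N) → Vec (Vec (Fin N) k) n → Bool
inPowerBlocks U u = all (λ b → all U (toList b)) (toList u)

UnkMinusΔS : {N : ℕ} → FinAbGroup N → (n k : ℕ) →
  Subset (Fin N) → Subset (Vec (Fin N) n) → Subset (Vec (Vec (Fin N) k) n)
UnkMinusΔS {N} G n k U S x =
  any (λ u → any (λ s →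
         inPowerBlocks U u ∧ S s ∧ ⌊ ≡-dec (≡-dec _≟ᶠ_) x (subBlocks G u (Δblocks n k s)) ⌋)
       (tuples N n))
     (blocks N n k)

sumset3 : {N : ℕ} → FinAbGroup N → Subset (Fin N) → Subset (Fin N) → Subset (Fin N) → Subset (Fin N)
sumset3 {N} G U A S x =
  any (λ u → any (λ a → any (λ s →
     U u ∧ A a ∧ S s ∧ ⌊ x ≟ᶠ _⊕_ G (_⊕_ G u a) s ⌋) (elems N)) (elems N)) (elems N)

AmMinusΔG : {N : ℕ} → FinAbGroup N → (m : ℕ) → Subset (Fin N) → Subset (Vec (Fin N) m)
AmMinusΔG {N} G m A x =
  any (λ a → any (λ g →
     all A (toList a) ∧ ⌊ ≡-dec _≟ᶠ_ x (zipWith (_⊝_ G) a (Δ m g)) ⌋) (elems N)) (tuples N m)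

{-# OPTIONS --safe #-}
-- By k-universality every block b ∈ Gᵏ has a shift w_b with b + Δ(w_b) ∈ Uᵏ. The map
-- (s, x) ↦ ((x_i + Δ(w_{x_i} − s_i))_i , (head x_i)_i) sends S × G^{nk} injectively into
-- (U^{nk} − Δ(S)) × Gⁿ, because the head of each block of the image, compared with head x_i,
-- returns w_{x_i} − s_i and hence x_i and s_i. For the sumset bound take n = m and
-- S′ = −(Aᵐ − Δ(G)): each y ∈ U^{mk} − Δ(S′) has a translate y + Δ(g_y) ∈ (U + A)^{mk}, so
-- (y, s) ↦ (y + Δ(g_y + s), g_y + s) injects (U^{mk} − Δ(S′)) × S into (U + A + S)^{mk} × G.
-- Chaining the two counts gives N^{km} |S| |Aᵐ − Δ(G)| ≤ |U + A + S|^{km} N^{1+m}.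
module Submission where

-- The record projections are hidden so that `open FinAbGroup G` below is unambiguous.
open import Defs hiding (_⊕_; ε; ⊖_; _⊝_; isAbelianGroup)
open import Algebra.Bundles using (AbelianGroup)
import Algebra.Properties.AbelianGroup as AbelianGroupProperties
open import Data.Bool using (Bool; true; false; T; _∧_; if_then_else_)
open import Data.Bool.ListAction using (any; all)
open import Data.Bool.Properties using (T-∧; T-≡)
open import Data.Fin using (Fin)
open import Data.Fin.Properties using (any?) renaming (_≟_ to _≟ᶠ_)
open import Data.List as List
  using (List; []; _∷_; _++_; length; concatMap; cartesianProductWith; cartesianProduct; filterᵇ; allFin)
open import Data.List.Membership.Propositional using (_∈_; lose)
open import Data.List.Membership.Propositional.Properties
  using (∈-∃++; ∈-++⁻; ∈-++⁺ˡ; ∈-++⁺ʳ; ∈-map⁻; ∈-filter⁺; ∈-filter⁻; ∈-cartesianProductWith⁺; ∈-cartesianProduct⁺; ∈-allFin)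
open import Data.List.Properties using (length-map; length-tabulate; length-++-sucʳ)
open import Data.List.Relation.Binary.Subset.Propositional using (_⊆_)
import Data.List.Relation.Unary.All as ListAll
open import Data.List.Relation.Unary.All.Properties using (all⁺; all⁻)
open import Data.List.Relation.Unary.AllPairs using ([]; _∷_)
open import Data.List.Relation.Unary.Any using (here; there; satisfied)
open import Data.List.Relation.Unary.Any.Properties using (any⁺; any⁻)
open import Data.List.Relation.Unary.Unique.Propositional using (Unique)
open import Data.List.Relation.Unary.Unique.Propositional.Properties
  using (map⁺; filter⁺; cartesianProductWith⁺; cartesianProduct⁺; allFin⁺)
open import Data.Nat using (ℕ; zero; suc; _*_; _^_; _+_; _≤_; _≥_; z≤n; s≤s)
open import Data.Nat.Properties using (*-comm; *-assoc; *-monoʳ-≤; *-monoˡ-≤; ^-*-assoc; module ≤-Reasoning)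
open import Data.Nat.Solver using (module +-*-Solver)
open import Data.Product using (∃; ∃₂; _×_; _,_; proj₁; proj₂)
open import Data.Sum using (inj₁; inj₂)
open import Data.Vec using (Vec; []; _∷_; head; lookup; toList; map; zipWith)
open import Data.Vec.Properties
  using (∷-injective; lookup-map; lookup-zipWith; lookup-replicate; map-∘; map-cong; map-id; zipWith-replicate₂)
open import Data.Vec.Relation.Unary.All.Properties using (lookup⁺; lookup⁻; toList⁺; toList⁻)
open import Function using (_∘_)
open import Function.Bundles using (Equivalence)
open import Function.Definitions using (Injective)
open import Level using (0ℓ)
open import Relation.Binary.PropositionalEquality
  using (_≡_; refl; sym; trans; cong; cong₂; subst; subst₂; module ≡-Reasoning)
open import Relation.Nullary using (yes; no; contradiction)
open import Relation.Nullary.Decidable using (⌊_⌋; T?; toWitness; fromWitness)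

open +-*-Solver using (solve; _:*_; _:=_)

T-∧⁺ : {a b : Bool} → T a → T b → T (a ∧ b)
T-∧⁺ Ta Tb = Equivalence.from T-∧ (Ta , Tb)

T-∧⁻ : {a b : Bool} → T (a ∧ b) → T a × T b
T-∧⁻ = Equivalence.to T-∧

map-injective : {A B : Set} {f : A → B} {n : ℕ} → Injective _≡_ _≡_ f → Injective _≡_ _≡_ (map {n = n} f)
map-injective {n = zero}  f-injective {[]}    {[]}    _  = refl
map-injective {n = suc n} f-injective {a ∷ v} {b ∷ w} eq =
  cong₂ _∷_ (f-injective (proj₁ (∷-injective eq))) (map-injective f-injective (proj₂ (∷-injective eq)))

module _ {A : Set} where

  count≡length∘filterᵇ : (xs : List A) (P : A → Bool) → count xs P ≡ length (filterᵇ P xs)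
  count≡length∘filterᵇ []       P = refl
  count≡length∘filterᵇ (x ∷ xs) P with P x
  ... | true  = cong suc (count≡length∘filterᵇ xs P)
  ... | false = count≡length∘filterᵇ xs P

  count-++ : (xs ys : List A) (P : A → Bool) → count (xs ++ ys) P ≡ count xs P + count ys P
  count-++ []       ys P = refl
  count-++ (x ∷ xs) ys P with P x
  ... | true  = cong suc (count-++ xs ys P)
  ... | false = count-++ xs ys P

  count-cong : (xs : List A) {P Q : A → Bool} → (∀ x → P x ≡ Q x) → count xs P ≡ count xs Q
  count-cong []       P≡Q = refl
  count-cong (x ∷ xs) {P} {Q} P≡Q rewrite P≡Q x with Q x
  ... | true  = cong suc (count-cong xs P≡Q)
  ... | false = count-cong xs P≡Q

  count-false : (xs : List A) → count xs (λ _ → false) ≡ 0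
  count-false []       = refl
  count-false (x ∷ xs) = count-false xs

  count-true : (xs : List A) → count xs (λ _ → true) ≡ length xs
  count-true []       = refl
  count-true (x ∷ xs) = cong suc (count-true xs)

  unique⊆⇒length≤ : {xs ys : List A} → Unique xs → xs ⊆ ys → length xs ≤ length ys
  unique⊆⇒length≤ {[]}     _             _     = z≤n
  unique⊆⇒length≤ {x ∷ xs} (x∉xs ∷ !xs) xs⊆ys with ∈-∃++ (xs⊆ys (here refl))
  ... | ys₁ , ys₂ , refl = begin
    suc (length xs)           ≤⟨ s≤s (unique⊆⇒length≤ !xs xs⊆ys₁++ys₂) ⟩
    suc (length (ys₁ ++ ys₂)) ≡⟨ length-++-sucʳ ys₁ x ys₂ ⟨
    length (ys₁ ++ x ∷ ys₂)   ∎
    where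
    open ≤-Reasoning
    xs⊆ys₁++ys₂ : xs ⊆ ys₁ ++ ys₂
    xs⊆ys₁++ys₂ {c} c∈xs with ∈-++⁻ ys₁ (xs⊆ys (there c∈xs))
    ... | inj₁ c∈ys₁         = ∈-++⁺ˡ c∈ys₁
    ... | inj₂ (here refl)   = contradiction refl (ListAll.lookup x∉xs c∈xs)
    ... | inj₂ (there c∈ys₂) = ∈-++⁺ʳ ys₁ c∈ys₂

  T-any⁺ : {p : A → Bool} {xs : List A} {x : A} → x ∈ xs → T (p x) → T (any p xs)
  T-any⁺ x∈xs px = any⁺ _ (lose x∈xs px)

  T-any⁻ : {p : A → Bool} (xs : List A) → T (any p xs) → ∃ λ x → T (p x)
  T-any⁻ xs h = satisfied (any⁻ _ xs h)

  T-all⁺ : (p : A → Bool) {n : ℕ} (v : Vec A n) → (∀ i → T (p (lookup v i))) → T (all p (toList v))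
  T-all⁺ p v pᵢ = all⁻ p (toList⁺ (lookup⁻ {xs = v} pᵢ))

  T-all⁻ : (p : A → Bool) {n : ℕ} (v : Vec A n) → T (all p (toList v)) → ∀ i → T (p (lookup v i))
  T-all⁻ p v all-p = lookup⁺ (toList⁻ (all⁺ p (toList v) all-p))

module _ {A B : Set} where

  count-map : (f : A → B) (xs : List A) (P : B → Bool) → count (List.map f xs) P ≡ count xs (P ∘ f)
  count-map f []       P = refl
  count-map f (x ∷ xs) P with P (f x)
  ... | true  = cong suc (count-map f xs P)
  ... | false = count-map f xs P

  count-mono-injective : {xs : List A} {ys : List B} {P : A → Bool} {Q : B → Bool} {f : A → B} →
    Unique xs → (∀ y → y ∈ ys) → Injective _≡_ _≡_ f → (∀ x → T (P x) → T (Q (f x))) →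
    count xs P ≤ count ys Q
  count-mono-injective {xs} {ys} {P} {Q} {f} !xs ys-complete f-injective P⇒Q∘f = begin
    count xs P                         ≡⟨ count≡length∘filterᵇ xs P ⟩
    length (filterᵇ P xs)              ≡⟨ length-map f (filterᵇ P xs) ⟨
    length (List.map f (filterᵇ P xs)) ≤⟨ unique⊆⇒length≤ (map⁺ f-injective (filter⁺ (T? ∘ P) !xs)) f[P]⊆Q ⟩
    length (filterᵇ Q ys)              ≡⟨ count≡length∘filterᵇ ys Q ⟨
    count ys Q                         ∎
    where
    open ≤-Reasoning
    f[P]⊆Q : List.map f (filterᵇ P xs) ⊆ filterᵇ Q ys
    f[P]⊆Q fx∈f[P] with ∈-map⁻ f fx∈f[P]
    ... | x , x∈P , refl =
      ∈-filter⁺ (T? ∘ Q) (ys-complete (f x)) (P⇒Q∘f x (proj₂ (∈-filter⁻ (T? ∘ P) {xs = xs} x∈P)))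

module _ {A B C : Set} where

  concatMap-map≡cartesianProductWith : (g : A → B → C) (xs : List A) (ys : List B) →
    concatMap (λ x → List.map (g x) ys) xs ≡ cartesianProductWith g xs ys
  concatMap-map≡cartesianProductWith g []       ys = refl
  concatMap-map≡cartesianProductWith g (x ∷ xs) ys =
    cong (List.map (g x) ys ++_) (concatMap-map≡cartesianProductWith g xs ys)

  count-cartesianProductWith : (g : A → B → C) (P : A → Bool) (Q : B → Bool) (R : C → Bool) →
    (∀ a b → R (g a b) ≡ P a ∧ Q b) →
    (xs : List A) (ys : List B) → count (cartesianProductWith g xs ys) R ≡ count xs P * count ys Q
  count-cartesianProductWith g P Q R R∘g []       ys = refl
  count-cartesianProductWith g P Q R R∘g (x ∷ xs) ys = begin
    count (List.map (g x) ys ++ cartesianProductWith g xs ys) R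
      ≡⟨ count-++ (List.map (g x) ys) _ R ⟩
    count (List.map (g x) ys) R + count (cartesianProductWith g xs ys) R
      ≡⟨ cong₂ _+_ (trans (count-map (g x) ys R) (count-cong ys (R∘g x)))
                   (count-cartesianProductWith g P Q R R∘g xs ys) ⟩
    count ys (λ y → P x ∧ Q y) + count xs P * count ys Q
      ≡⟨ row (P x) ⟩
    count (x ∷ xs) P * count ys Q ∎
    where
    open ≡-Reasoning
    row : ∀ b → count ys (λ y → b ∧ Q y) + count xs P * count ys Q
              ≡ (if b then suc (count xs P) else count xs P) * count ys Q
    row true  = refl
    row false = cong (_+ count xs P * count ys Q) (count-false ys)

module _ {A B : Set} where

  count-cartesianProduct : (xs : List A) (ys : List B) (P : A → Bool) (Q : B → Bool) →
    count (cartesianProduct xs ys) (λ ab → P (proj₁ ab) ∧ Q (proj₂ ab)) ≡ count xs P * count ys Q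
  count-cartesianProduct xs ys P Q = count-cartesianProductWith _,_ P Q _ (λ _ _ → refl) xs ys

module _ {A B C D : Set} where

  count-×-mono-injective : {xs : List A} {ys : List B} {zs : List C} {ws : List D}
    {P : A → Bool} {Q : B → Bool} {R : C → Bool} →
    Unique xs → Unique ys → (∀ z → z ∈ zs) → (∀ w → w ∈ ws) →
    (f : A × B → C × D) → Injective _≡_ _≡_ f →
    (∀ a b → T (P a) → T (Q b) → T (R (proj₁ (f (a , b))))) →
    count xs P * count ys Q ≤ count zs R * count ws (λ _ → true)
  count-×-mono-injective {xs} {ys} {zs} {ws} {P} {Q} {R} !xs !ys zs-complete ws-complete f f-injective f-maps =
    subst₂ _≤_ (count-cartesianProduct xs ys P Q) (count-cartesianProduct zs ws R (λ _ → true))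
      (count-mono-injective (cartesianProduct⁺ !xs !ys) zs×ws-complete f-injective P×Q⇒R∘f)
    where
    zs×ws-complete : ∀ zw → zw ∈ cartesianProduct zs ws
    zs×ws-complete (z , w) = ∈-cartesianProduct⁺ (zs-complete z) (ws-complete w)
    P×Q⇒R∘f : ∀ ab → T (P (proj₁ ab) ∧ Q (proj₂ ab)) → T (R (proj₁ (f ab)) ∧ true)
    P×Q⇒R∘f (a , b) Pa∧Qb = let Pa , Qb = T-∧⁻ Pa∧Qb in T-∧⁺ (f-maps a b Pa Qb) _

module _ {A : Set} where

  vecs-suc : (xs : List A) (n : ℕ) → vecs xs (suc n) ≡ cartesianProductWith _∷_ xs (vecs xs n)
  vecs-suc xs n = concatMap-map≡cartesianProductWith _∷_ xs (vecs xs n)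

  vecs-unique : {xs : List A} (n : ℕ) → Unique xs → Unique (vecs xs n)
  vecs-unique zero    !xs = ListAll.[] ∷ []
  vecs-unique {xs} (suc n) !xs rewrite vecs-suc xs n =
    cartesianProductWith⁺ _∷_ ∷-injective !xs (vecs-unique n !xs)

  vecs-complete : {xs : List A} (n : ℕ) → (∀ x → x ∈ xs) → (v : Vec A n) → v ∈ vecs xs n
  vecs-complete zero    xs-complete []      = here refl
  vecs-complete {xs} (suc n) xs-complete (x ∷ v) rewrite vecs-suc xs n =
    ∈-cartesianProductWith⁺ _∷_ (xs-complete x) (vecs-complete n xs-complete v)

  count-vecs : (P : A → Bool) (R : ∀ {n} → Vec A n → Bool) →
    R [] ≡ true → (∀ {n} x (v : Vec A n) → R (x ∷ v) ≡ P x ∧ R v) →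
    (xs : List A) (n : ℕ) → count (vecs xs n) R ≡ count xs P ^ n
  count-vecs P R R[] R∷ xs zero rewrite R[] = refl
  count-vecs P R R[] R∷ xs (suc n) = begin
    count (vecs xs (suc n)) R                         ≡⟨ cong (λ vs → count vs R) (vecs-suc xs n) ⟩
    count (cartesianProductWith _∷_ xs (vecs xs n)) R
      ≡⟨ count-cartesianProductWith _∷_ P R R R∷ xs (vecs xs n) ⟩
    count xs P * count (vecs xs n) R
      ≡⟨ cong (count xs P *_) (count-vecs P R R[] R∷ xs n) ⟩
    count xs P ^ suc n ∎
    where open ≡-Reasoning

  count-vecs-true : (xs : List A) (n : ℕ) → count (vecs xs n) (λ _ → true) ≡ count xs (λ _ → true) ^ n
  count-vecs-true = count-vecs (λ _ → true) (λ _ → true) refl (λ _ _ → refl)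

  count-vecs-all : (P : A → Bool) (xs : List A) (n : ℕ) → count (vecs xs n) (λ v → all P (toList v)) ≡ count xs P ^ n
  count-vecs-all P = count-vecs P (λ v → all P (toList v)) refl (λ _ _ → refl)

module _ (N : ℕ) where

  tuples-unique : (n : ℕ) → Unique (tuples N n)
  tuples-unique n = vecs-unique n (allFin⁺ N)

  tuples-complete : (n : ℕ) (v : Vec (Fin N) n) → v ∈ tuples N n
  tuples-complete n = vecs-complete n ∈-allFin

  blocks-unique : (n k : ℕ) → Unique (blocks N n k)
  blocks-unique n k = vecs-unique n (tuples-unique k)

  blocks-complete : (n k : ℕ) (x : Vec (Vec (Fin N) k) n) → x ∈ blocks N n k
  blocks-complete n k = vecs-complete n (tuples-complete k)

  count-elems-true : count (elems N) (λ _ → true) ≡ N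
  count-elems-true = trans (count-true (allFin N)) (length-tabulate (λ i → i))

  count-tuples-true : (n : ℕ) → count (tuples N n) (λ _ → true) ≡ N ^ n
  count-tuples-true n = trans (count-vecs-true (allFin N) n) (cong (_^ n) count-elems-true)

  count-blocks-true : (n k : ℕ) → count (blocks N n k) (λ _ → true) ≡ N ^ (n * k)
  count-blocks-true n k = begin
    count (blocks N n k) (λ _ → true)   ≡⟨ count-vecs-true (tuples N k) n ⟩
    count (tuples N k) (λ _ → true) ^ n ≡⟨ cong (_^ n) (count-tuples-true k) ⟩
    (N ^ k) ^ n                         ≡⟨ ^-*-assoc N k n ⟩
    N ^ (k * n)                         ≡⟨ cong (N ^_) (*-comm k n) ⟩
    N ^ (n * k)                         ∎
    where open ≡-Reasoning

  cardⁿᵏ-inPowerBlocks : (n k : ℕ) (X : Subset (Fin N)) → cardⁿᵏ n k (inPowerBlocks X) ≡ card X ^ (k * n)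
  cardⁿᵏ-inPowerBlocks n k X = begin
    cardⁿᵏ n k (inPowerBlocks X)                    ≡⟨ count-vecs-all (λ b → all X (toList b)) (tuples N k) n ⟩
    count (tuples N k) (λ b → all X (toList b)) ^ n ≡⟨ cong (_^ n) (count-vecs-all X (allFin N) k) ⟩
    (card X ^ k) ^ n                                ≡⟨ ^-*-assoc (card X) k n ⟩
    card X ^ (k * n)                                ∎
    where open ≡-Reasoning

module _ {N : ℕ} where

  inPowerBlocks⁺ : {n k : ℕ} (X : Subset (Fin N)) (x : Vec (Vec (Fin N) k) n) →
    (∀ i j → T (X (lookup (lookup x i) j))) → T (inPowerBlocks X x)
  inPowerBlocks⁺ X x xᵢⱼ∈X = T-all⁺ _ x (λ i → T-all⁺ X (lookup x i) (xᵢⱼ∈X i))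

  inPowerBlocks⁻ : {n k : ℕ} (X : Subset (Fin N)) (x : Vec (Vec (Fin N) k) n) →
    T (inPowerBlocks X x) → ∀ i j → T (X (lookup (lookup x i) j))
  inPowerBlocks⁻ X x x∈Xⁿᵏ i = T-all⁻ X (lookup x i) (T-all⁻ _ x x∈Xⁿᵏ i)

module _ {N : ℕ} (p : Fin N → Bool) (default : Fin N) where

  choose : Fin N
  choose with any? (λ i → T? (p i))
  ... | yes (i , _) = i
  ... | no _        = default

  choose-correct : (∃ λ i → T (p i)) → T (p choose)
  choose-correct ∃i with any? (λ i → T? (p i))
  ... | yes (_ , pᵢ) = pᵢ
  ... | no ∄i        = contradiction ∃i ∄i

combine-bounds : {a a′ b c d P Q R : ℕ} →
  a ≤ a′ → a′ * P ≤ b * Q → b * c ≤ d * R → P * c * a ≤ d * (R * Q)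
combine-bounds {a} {a′} {b} {c} {d} {P} {Q} {R} a≤a′ a′P≤bQ bc≤dR = begin
  P * c * a    ≤⟨ *-monoʳ-≤ (P * c) a≤a′ ⟩
  P * c * a′   ≡⟨ solve 3 (λ P c a′ → P :* c :* a′ := c :* (a′ :* P)) refl P c a′ ⟩
  c * (a′ * P) ≤⟨ *-monoʳ-≤ c a′P≤bQ ⟩
  c * (b * Q)  ≡⟨ solve 3 (λ c b Q → c :* (b :* Q) := b :* c :* Q) refl c b Q ⟩
  b * c * Q    ≤⟨ *-monoˡ-≤ Q bc≤dR ⟩
  d * R * Q    ≡⟨ *-assoc d R Q ⟩
  d * (R * Q)  ∎
  where open ≤-Reasoning

module _ {N : ℕ} (G : FinAbGroup N) where

  open FinAbGroup G

  abelianGroup : AbelianGroup 0ℓ 0ℓ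
  abelianGroup = record
    { Carrier = Fin N ; _≈_ = _≡_ ; _∙_ = _⊕_ ; ε = ε ; _⁻¹ = ⊖_ ; isAbelianGroup = isAbelianGroup }

  open AbelianGroup abelianGroup using (assoc)
  open AbelianGroupProperties abelianGroup
    using (∙-cancelˡ; ∙-cancelʳ; ⁻¹-injective; ⁻¹-involutive; //-rightDividesˡ)

  _⊕ᵛ_ : {k : ℕ} → Vec (Fin N) k → Fin N → Vec (Fin N) k
  v ⊕ᵛ g = map (_⊕ g) v

  _⊕ᵇ_ : {n k : ℕ} → Vec (Vec (Fin N) k) n → Fin N → Vec (Vec (Fin N) k) n
  x ⊕ᵇ g = map (_⊕ᵛ g) x

  infixl 6 _⊕ᵛ_ _⊕ᵇ_

  ⊕ᵛ-cancelʳ : {k : ℕ} {v w : Vec (Fin N) k} (g : Fin N) → v ⊕ᵛ g ≡ w ⊕ᵛ g → v ≡ w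
  ⊕ᵛ-cancelʳ g = map-injective (∙-cancelʳ g _ _)

  ⊕ᵇ-cancelʳ : {n k : ℕ} {x y : Vec (Vec (Fin N) k) n} (g : Fin N) → x ⊕ᵇ g ≡ y ⊕ᵇ g → x ≡ y
  ⊕ᵇ-cancelʳ g = map-injective (⊕ᵛ-cancelʳ g)

  ⊕ᵛ-assoc : {k : ℕ} (v : Vec (Fin N) k) (g h : Fin N) → v ⊕ᵛ g ⊕ᵛ h ≡ v ⊕ᵛ (g ⊕ h)
  ⊕ᵛ-assoc v g h = trans (sym (map-∘ (_⊕ h) (_⊕ g) v)) (map-cong (λ a → assoc a g h) v)

  ⊕ᵇ-assoc : {n k : ℕ} (x : Vec (Vec (Fin N) k) n) (g h : Fin N) → x ⊕ᵇ g ⊕ᵇ h ≡ x ⊕ᵇ (g ⊕ h)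
  ⊕ᵇ-assoc x g h = trans (sym (map-∘ (_⊕ᵛ h) (_⊕ᵛ g) x)) (map-cong (λ v → ⊕ᵛ-assoc v g h) x)

  ⊕ᵛ-head-injective : {k : ℕ} {v w : Vec (Fin N) (suc k)} {d e : Fin N} →
    v ⊕ᵛ d ≡ w ⊕ᵛ e → head v ≡ head w → v ≡ w × d ≡ e
  ⊕ᵛ-head-injective {v = a ∷ v} {.a ∷ w} eq refl with ∷-injective eq
  ... | a⊕d≡a⊕e , v⊕d≡w⊕e with ∙-cancelˡ a _ _ a⊕d≡a⊕e
  ... | refl = cong (a ∷_) (⊕ᵛ-cancelʳ _ v⊕d≡w⊕e) , refl

  ⊕ᵛ-⊝-Δ : {k : ℕ} (v : Vec (Fin N) k) (g h : Fin N) → zipWith _⊝_ (v ⊕ᵛ g) (Δ k h) ≡ v ⊕ᵛ (g ⊝ h)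
  ⊕ᵛ-⊝-Δ v g h = trans (zipWith-replicate₂ _⊝_ (v ⊕ᵛ g) h) (⊕ᵛ-assoc v g (⊖ h))

  lookup-⊕ᵇ : {n k : ℕ} (x : Vec (Vec (Fin N) k) n) (g : Fin N) (i : Fin n) (j : Fin k) →
    lookup (lookup (x ⊕ᵇ g) i) j ≡ lookup (lookup x i) j ⊕ g
  lookup-⊕ᵇ x g i j rewrite lookup-map i (_⊕ᵛ g) x = lookup-map j (_⊕ g) (lookup x i)

  lookup-subBlocks : {n k : ℕ} (u : Vec (Vec (Fin N) k) n) (s : Vec (Fin N) n) (i : Fin n) (j : Fin k) →
    lookup (lookup (subBlocks G u (Δblocks n k s)) i) j ≡ lookup (lookup u i) j ⊝ lookup s i
  lookup-subBlocks {n} {k} u s i j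
    rewrite lookup-zipWith (zipWith _⊝_) i u (Δblocks n k s) | lookup-map i (Δ k) s
    = trans (lookup-zipWith _⊝_ j (lookup u i) (Δ k (lookup s i)))
            (cong (lookup (lookup u i) j ⊝_) (lookup-replicate j (lookup s i)))

  sumset : Subset (Fin N) → Subset (Fin N) → Subset (Fin N)
  sumset X Y z = any (λ x → any (λ y → X x ∧ Y y ∧ ⌊ z ≟ᶠ x ⊕ y ⌋) (elems N)) (elems N)

  sumset⁺ : (X Y : Subset (Fin N)) {x y : Fin N} → T (X x) → T (Y y) → T (sumset X Y (x ⊕ y))
  sumset⁺ X Y {x} {y} x∈X y∈Y =
    T-any⁺ (∈-allFin x) (T-any⁺ (∈-allFin y) (T-∧⁺ x∈X (T-∧⁺ y∈Y (fromWitness refl))))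

  sumset⁻ : (X Y : Subset (Fin N)) (z : Fin N) → T (sumset X Y z) →
    ∃₂ λ x y → T (X x) × T (Y y) × z ≡ x ⊕ y
  sumset⁻ X Y z z∈X+Y =
    let x , z∈x+Y = T-any⁻ (elems N) z∈X+Y
        y , x∈X∧y∈Y∧z≡x+y = T-any⁻ (elems N) z∈x+Y
        x∈X , y∈Y∧z≡x+y = T-∧⁻ x∈X∧y∈Y∧z≡x+y
        y∈Y , z≡x+y = T-∧⁻ y∈Y∧z≡x+y
    in x , y , x∈X , y∈Y , toWitness z≡x+y

  sumset3⁺ : (U A S : Subset (Fin N)) (z s : Fin N) →
    T (sumset U A z) → T (S s) → T (sumset3 G U A S (z ⊕ s))
  sumset3⁺ U A S z s z∈U+A s∈S with sumset⁻ U A z z∈U+A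
  ... | u , a , u∈U , a∈A , refl =
    T-any⁺ (∈-allFin u) (T-any⁺ (∈-allFin a) (T-any⁺ (∈-allFin s)
      (T-∧⁺ u∈U (T-∧⁺ a∈A (T-∧⁺ s∈S (fromWitness refl))))))

  UnkMinusΔS⁺ : {n k : ℕ} (U : Subset (Fin N)) (S : Subset (Vec (Fin N) n))
    (u : Vec (Vec (Fin N) k) n) (s : Vec (Fin N) n) →
    T (inPowerBlocks U u) → T (S s) → T (UnkMinusΔS G n k U S (subBlocks G u (Δblocks n k s)))
  UnkMinusΔS⁺ {n} {k} U S u s u∈Uⁿᵏ s∈S =
    T-any⁺ (blocks-complete N n k u) (T-any⁺ (tuples-complete N n s)
      (T-∧⁺ u∈Uⁿᵏ (T-∧⁺ s∈S (fromWitness refl))))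

  UnkMinusΔS⁻ : {n k : ℕ} (U : Subset (Fin N)) (S : Subset (Vec (Fin N) n)) (x : Vec (Vec (Fin N) k) n) →
    T (UnkMinusΔS G n k U S x) →
    ∃₂ λ u s → T (inPowerBlocks U u) × T (S s) × x ≡ subBlocks G u (Δblocks n k s)
  UnkMinusΔS⁻ {n} {k} U S x x∈Uⁿᵏ-ΔS =
    let u , x∈u-ΔS = T-any⁻ (blocks N n k) x∈Uⁿᵏ-ΔS
        s , u∈Uⁿᵏ∧s∈S∧x≡u-Δs = T-any⁻ (tuples N n) x∈u-ΔS
        u∈Uⁿᵏ , s∈S∧x≡u-Δs = T-∧⁻ u∈Uⁿᵏ∧s∈S∧x≡u-Δs
        s∈S , x≡u-Δs = T-∧⁻ s∈S∧x≡u-Δs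
    in u , s , u∈Uⁿᵏ , s∈S , toWitness x≡u-Δs

  AmMinusΔG⁻ : {m : ℕ} (A : Subset (Fin N)) (x : Vec (Fin N) m) → T (AmMinusΔG G m A x) →
    ∃₂ λ a g → T (all A (toList a)) × x ≡ zipWith _⊝_ a (Δ m g)
  AmMinusΔG⁻ {m} A x x∈Aᵐ-ΔG =
    let a , x∈a-ΔG = T-any⁻ (tuples N m) x∈Aᵐ-ΔG
        g , a∈Aᵐ∧x≡a-Δg = T-any⁻ (elems N) x∈a-ΔG
        a∈Aᵐ , x≡a-Δg = T-∧⁻ a∈Aᵐ∧x≡a-Δg
    in a , g , a∈Aᵐ , toWitness x≡a-Δg

  inPowerBlocks-sumset-⊕ᵇ : {n k : ℕ} (U A S : Subset (Fin N)) (x : Vec (Vec (Fin N) k) n) (s : Fin N) →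
    T (inPowerBlocks (sumset U A) x) → T (S s) → T (inPowerBlocks (sumset3 G U A S) (x ⊕ᵇ s))
  inPowerBlocks-sumset-⊕ᵇ U A S x s x∈[U+A]ⁿᵏ s∈S = inPowerBlocks⁺ (sumset3 G U A S) (x ⊕ᵇ s) λ i j →
    subst (T ∘ sumset3 G U A S) (sym (lookup-⊕ᵇ x s i j))
      (sumset3⁺ U A S _ s (inPowerBlocks⁻ (sumset U A) x x∈[U+A]ⁿᵏ i j) s∈S)

  module _ {k : ℕ} (U : Subset (Fin N)) (U-universal : KUniversal G (suc k) U) where

    shiftIntoU : Vec (Fin N) (suc k) → Fin N
    shiftIntoU b = proj₁ (U-universal b)

    liftIntoU : Vec (Fin N) (suc k) → Vec (Fin N) (suc k)
    liftIntoU b = b ⊕ᵛ shiftIntoU b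

    liftIntoU-∈Uⁿᵏ : {n : ℕ} (x : Vec (Vec (Fin N) (suc k)) n) → T (inPowerBlocks U (map liftIntoU x))
    liftIntoU-∈Uⁿᵏ x = inPowerBlocks⁺ U (map liftIntoU x) entry
      where
      entry : ∀ i j → T (U (lookup (lookup (map liftIntoU x) i) j))
      entry i j rewrite lookup-map i liftIntoU x | lookup-map j (_⊕ shiftIntoU (lookup x i)) (lookup x i)
        = Equivalence.from T-≡ (proj₂ (U-universal (lookup x i)) j)

    liftIntoU-⊝-Δ-injective : {b b′ : Vec (Fin N) (suc k)} {σ σ′ : Fin N} →
      zipWith _⊝_ (liftIntoU b) (Δ (suc k) σ) ≡ zipWith _⊝_ (liftIntoU b′) (Δ (suc k) σ′) →
      head b ≡ head b′ → σ ≡ σ′ × b ≡ b′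
    liftIntoU-⊝-Δ-injective {b} {b′} {σ} {σ′} eq head-b≡head-b′
      with ⊕ᵛ-head-injective (trans (sym (⊕ᵛ-⊝-Δ b _ σ)) (trans eq (⊕ᵛ-⊝-Δ b′ _ σ′))) head-b≡head-b′
    ... | refl , w-σ≡w-σ′ = ⁻¹-injective (∙-cancelˡ (shiftIntoU b) _ _ w-σ≡w-σ′) , refl

    liftDifference : {n : ℕ} → Vec (Fin N) n × Vec (Vec (Fin N) (suc k)) n →
      Vec (Vec (Fin N) (suc k)) n × Vec (Fin N) n
    liftDifference {n} (s , x) = subBlocks G (map liftIntoU x) (Δblocks n (suc k) s) , map head x

    liftDifference-injective : {n : ℕ} → Injective _≡_ _≡_ (liftDifference {n})
    liftDifference-injective {zero}  {[] , []}        {[] , []}          _  = refl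
    liftDifference-injective {suc n} {σ ∷ s , b ∷ x} {σ′ ∷ s′ , b′ ∷ x′} eq
      with ∷-injective (cong proj₁ eq) | ∷-injective (cong proj₂ eq)
    ... | first≡ , rest≡ | head≡ , heads≡
      with liftIntoU-⊝-Δ-injective first≡ head≡
         | liftDifference-injective {n} {s , x} {s′ , x′} (cong₂ _,_ rest≡ heads≡)
    ... | refl , refl | refl = refl

    UnkMinusΔS-lower-bound : (n : ℕ) (S : Subset (Vec (Fin N) n)) →
      cardⁿ n S * N ^ (n * suc k) ≤ cardⁿᵏ n (suc k) (UnkMinusΔS G n (suc k) U S) * N ^ n
    UnkMinusΔS-lower-bound n S =
      subst₂ _≤_ (cong (cardⁿ n S *_) (count-blocks-true N n (suc k)))
                 (cong (cardⁿᵏ n (suc k) (UnkMinusΔS G n (suc k) U S) *_) (count-tuples-true N n))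
        (count-×-mono-injective (tuples-unique N n) (blocks-unique N n (suc k))
           (blocks-complete N n (suc k)) (tuples-complete N n)
           liftDifference liftDifference-injective
           (λ s x s∈S _ → UnkMinusΔS⁺ U S (map liftIntoU x) s (liftIntoU-∈Uⁿᵏ x) s∈S))

  translation-bound : {n k : ℕ} (Y W Z : Subset (Vec (Vec (Fin N) k) n)) (S : Subset (Fin N)) →
    (∀ y → T (Y y) → ∃ λ g → T (W (y ⊕ᵇ g))) →
    (∀ x s → T (W x) → T (S s) → T (Z (x ⊕ᵇ s))) →
    cardⁿᵏ n k Y * card S ≤ cardⁿᵏ n k Z * N
  translation-bound {n} {k} Y W Z S Y⊆W-ΔG W+S⊆Z =
    subst (cardⁿᵏ n k Y * card S ≤_) (cong (cardⁿᵏ n k Z *_) (count-elems-true N))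
      (count-×-mono-injective (blocks-unique N n k) (allFin⁺ N) (blocks-complete N n k) ∈-allFin
         translate translate-injective translate-maps)
    where
    shiftIntoW : Vec (Vec (Fin N) k) n → Fin N
    shiftIntoW y = choose (λ g → W (y ⊕ᵇ g)) ε
    translate : Vec (Vec (Fin N) k) n × Fin N → Vec (Vec (Fin N) k) n × Fin N
    translate (y , s) = y ⊕ᵇ (shiftIntoW y ⊕ s) , shiftIntoW y ⊕ s
    -- The second component is the total shift, so it recovers y and then s.
    translate-injective : Injective _≡_ _≡_ translate
    translate-injective {y , s} {y′ , s′} eq
      with ⊕ᵇ-cancelʳ _ (trans (cong proj₁ eq) (cong (y′ ⊕ᵇ_) (sym (cong proj₂ eq))))
    ... | refl = cong (y ,_) (∙-cancelˡ (shiftIntoW y) s s′ (cong proj₂ eq))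
    translate-maps : ∀ y s → T (Y y) → T (S s) → T (Z (proj₁ (translate (y , s))))
    translate-maps y s y∈Y s∈S = subst (T ∘ Z) (⊕ᵇ-assoc y (shiftIntoW y) s)
      (W+S⊆Z _ s (choose-correct (λ g → W (y ⊕ᵇ g)) ε (Y⊆W-ΔG y y∈Y)) s∈S)

  negate : {m : ℕ} → Subset (Vec (Fin N) m) → Subset (Vec (Fin N) m)
  negate X v = X (map ⊖_ v)

  cardⁿ-negate : {m : ℕ} (X : Subset (Vec (Fin N) m)) → cardⁿ m X ≤ cardⁿ m (negate X)
  cardⁿ-negate {m} X = count-mono-injective (tuples-unique N m) (tuples-complete N m)
    (map-injective ⁻¹-injective) (λ v → subst (T ∘ X) (sym (map-⊖-involutive v)))
    where
    map-⊖-involutive : (v : Vec (Fin N) m) → map ⊖_ (map ⊖_ v) ≡ v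
    map-⊖-involutive v = trans (sym (map-∘ ⊖_ ⊖_ v)) (trans (map-cong ⁻¹-involutive v) (map-id v))

  UnkMinusΔS-negate-translate : {m k : ℕ} (U A : Subset (Fin N)) (y : Vec (Vec (Fin N) k) m) →
    T (UnkMinusΔS G m k U (negate (AmMinusΔG G m A)) y) →
    ∃ λ g → T (inPowerBlocks (sumset U A) (y ⊕ᵇ g))
  UnkMinusΔS-negate-translate {m} {k} U A y y∈Uᵐᵏ-ΔS
    with UnkMinusΔS⁻ U (negate (AmMinusΔG G m A)) y y∈Uᵐᵏ-ΔS
  ... | u , s , u∈Uᵐᵏ , -s∈Aᵐ-ΔG , refl with AmMinusΔG⁻ A (map ⊖_ s) -s∈Aᵐ-ΔG
  ... | a , g , a∈Aᵐ , -s≡a-Δg = g , inPowerBlocks⁺ (sumset U A) (u-Δs ⊕ᵇ g) λ i j →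
    subst (T ∘ sumset U A) (sym (entry i j))
      (sumset⁺ U A (inPowerBlocks⁻ U u u∈Uᵐᵏ i j) (T-all⁻ A a a∈Aᵐ i))
    where
    open ≡-Reasoning
    u-Δs : Vec (Vec (Fin N) k) m
    u-Δs = subBlocks G u (Δblocks m k s)
    -sᵢ≡aᵢ-g : ∀ i → ⊖ lookup s i ≡ lookup a i ⊝ g
    -sᵢ≡aᵢ-g i = begin
      ⊖ lookup s i                     ≡⟨ lookup-map i ⊖_ s ⟨
      lookup (map ⊖_ s) i              ≡⟨ cong (λ v → lookup v i) -s≡a-Δg ⟩
      lookup (zipWith _⊝_ a (Δ m g)) i ≡⟨ lookup-zipWith _⊝_ i a (Δ m g) ⟩
      lookup a i ⊝ lookup (Δ m g) i    ≡⟨ cong (lookup a i ⊝_) (lookup-replicate i g) ⟩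
      lookup a i ⊝ g                   ∎
    entry : ∀ i j → lookup (lookup (u-Δs ⊕ᵇ g) i) j ≡ lookup (lookup u i) j ⊕ lookup a i
    entry i j = let uᵢⱼ = lookup (lookup u i) j ; aᵢ = lookup a i in begin
      lookup (lookup (u-Δs ⊕ᵇ g) i) j ≡⟨ lookup-⊕ᵇ u-Δs g i j ⟩
      lookup (lookup u-Δs i) j ⊕ g    ≡⟨ cong (_⊕ g) (lookup-subBlocks u s i j) ⟩
      (uᵢⱼ ⊕ (⊖ lookup s i)) ⊕ g      ≡⟨ cong (λ t → (uᵢⱼ ⊕ t) ⊕ g) (-sᵢ≡aᵢ-g i) ⟩
      (uᵢⱼ ⊕ (aᵢ ⊝ g)) ⊕ g            ≡⟨ cong (_⊕ g) (assoc uᵢⱼ aᵢ (⊖ g)) ⟨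
      ((uᵢⱼ ⊕ aᵢ) ⊝ g) ⊕ g            ≡⟨ //-rightDividesˡ g (uᵢⱼ ⊕ aᵢ) ⟩
      uᵢⱼ ⊕ aᵢ                        ∎

  sumset3-lower-bound : {k : ℕ} (U : Subset (Fin N)) → KUniversal G (suc k) U →
    (A S : Subset (Fin N)) (m : ℕ) →
    N ^ (suc k * m) * card S * cardⁿ m (AmMinusΔG G m A)
      ≤ card (sumset3 G U A S) ^ (suc k * m) * N ^ (1 + m)
  sumset3-lower-bound {k} U U-universal A S m =
    subst (λ z → _ ≤ z * N ^ (1 + m)) (cardⁿᵏ-inPowerBlocks N m (suc k) (sumset3 G U A S))
      (combine-bounds {b = cardⁿᵏ m (suc k) Y} {d = cardⁿᵏ m (suc k) Z} {Q = N ^ m} {R = N}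
        (cardⁿ-negate (AmMinusΔG G m A))
        (subst (λ e → cardⁿ m S′ * N ^ e ≤ cardⁿᵏ m (suc k) Y * N ^ m) (*-comm m (suc k))
          (UnkMinusΔS-lower-bound U U-universal m S′))
        (translation-bound Y (inPowerBlocks (sumset U A)) Z S
          (UnkMinusΔS-negate-translate U A) (inPowerBlocks-sumset-⊕ᵇ U A S)))
    where
    S′ : Subset (Vec (Fin N) m)
    S′ = negate (AmMinusΔG G m A)
    Y : Subset (Vec (Vec (Fin N) (suc k)) m)
    Y = UnkMinusΔS G m (suc k) U S′
    Z : Subset (Vec (Vec (Fin N) (suc k)) m)
    Z = inPowerBlocks (sumset3 G U A S)

corollary16 : (N : ℕ) (G : FinAbGroup N) (k : ℕ) → 1 ≤ k →
    (U : Subset (Fin N)) → KUniversal G k U →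
    ((n : ℕ) → 1 ≤ n → (S : Subset (Vec (Fin N) n)) →
       cardⁿᵏ n k (UnkMinusΔS G n k U S) * N ^ n ≥ cardⁿ n S * N ^ (n * k))
    ×
    ((A S : Subset (Fin N)) (m : ℕ) → 1 ≤ m →
       card (sumset3 G U A S) ^ (k * m) * N ^ (1 + m)
         ≥ N ^ (k * m) * card S * cardⁿ m (AmMinusΔG G m A))
corollary16 N G (suc k) (s≤s z≤n) U U-universal =
  (λ n _ S → UnkMinusΔS-lower-bound G U U-universal n S) ,
  (λ A S m _ → sumset3-lower-bound G U U-universal A S m)
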